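{- Fix a vocabulary $\tau$ whose set of constants $\mathrm{Const}(\tau)$ is countably infinite. In inferential $\omega$-logic, for any countable set of constants $C\supseteq\mathrm{Const}(\tau)$, any admissible valuation $v_C$, and any $\tau(C)$-formula $\phi(x,\bar d)$ (with parameters $\bar d$ from $C$): $v_C((\forall x)\phi(x,\bar d))=\mathrm{true}$ if and only if $v_C(\phi(c,\bar d))=\mathrm{true}$ for each constant $c\in\mathrm{Const}(\tau)$.
   Context: $\tau(C)$ denotes $\tau$ expanded by the constants in $C$. Truth in a structure follows the Robinson semantics: a structure $M$ is expanded to the vocabulary $\tau_M$ with a constant naming each element, and $M\models(\forall x)\phi(x,\bar a)$ iff $M\models\phi(c,\bar a)$ for every constant $c$ of $\tau_M$. A valuation assigns truth values to sentences; it is permissible if it assigns values to all quantifier-free sentences, the sentences it makes true are consistent, and it preserves soundness of the identity rules; it is admissible for a set of rules if every rule instance with all premises true has a true conclusion. Inferential $\omega$-logic extends classical first-order natural deduction (with categorical propositional rules) by, for any countable $C\supseteq\mathrm{Const}(\tau)$ and any $\tau(C)$-formula $\phi(x,\bar d)$: $I$-$\omega$-rule: from all of $\{\phi(c,\bar d):c\in\mathrm{Const}(\tau)\}$ infer $(\forall x)\phi(x,\bar d)$; $I$-$\forall E$: from $(\forall x)\phi(x,\bar d)$ infer $\phi(c,\bar d)$ for each $c\in C$; $I$-$\exists I$: from $\phi(c,\bar d)$ for some $c\in C$ infer $(\exists x)\phi(x,\bar d)$; $I$-$\exists E$: from $(\exists x)\phi(x,\bar d)$ infer the disjunctive set $\{\phi(c,\bar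 d):c\in C\}$. -}

module Defs where

open import Data.Nat using (ℕ; zero; suc)
open import Data.Fin using (Fin; zero; suc; punchOut; _≟_)
open import Data.Vec using (Vec; []; _∷_)
open import Data.Bool using (Bool; true; false)
open import Data.Maybe using (Maybe; just; nothing)
open import Data.Product using (Σ; _×_; _,_)
open import Relation.Binary.PropositionalEquality using (_≡_)
open import Relation.Nullary using (yes; no)
open import Function.Bundles using (_↔_; _↣_)
open import Function.Definitions using (Injective)

record Vocabulary : Set₁ where
  field
    Rel       : Set
    relArity  : Rel → ℕ
    Fun       : Set
    funArity  : Fun → ℕ
    Const     : Set
    constEnum : ℕ ↔ Const

open Vocabulary public

-- A countable set of constants C ⊇ Const(τ): a set C, an injective
-- embedding of Const(τ) into C, and an injection of C into ℕ.
record ConstExpansion (τ : Vocabulary) : Set₁ where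
  field
    C         : Set
    embed     : Const τ → C
    embed-inj : Injective _≡_ _≡_ embed
    countable : C ↣ ℕ

open ConstExpansion public

module _ (τ : Vocabulary) (K : Set) where

  data Term (n : ℕ) : Set where
    var : Fin n → Term n
    con : K → Term n
    app : (f : Fun τ) → Vec (Term n) (funArity τ f) → Term n

  data Formula (n : ℕ) : Set where
    rel      : (R : Rel τ) → Vec (Term n) (relArity τ R) → Formula n
    _≐_      : Term n → Term n → Formula n
    ⊥̇        : Formula n
    ¬̇_       : Formula n → Formula n
    _∧̇_ _∨̇_ _⇒̇_ : Formula n → Formula n → Formula n
    ∀̇ ∃̇      : Formula (suc n) → Formula n

  Sentence : Set
  Sentence = Formula zero

module _ {τ : Vocabulary} {K : Set} where

  substTerm : ∀ {n} → Fin (suc n) → K → Term τ K (suc n) → Term τ K n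
  substTerms : ∀ {n m} → Fin (suc n) → K → Vec (Term τ K (suc n)) m → Vec (Term τ K n) m
  substTerm i c (var j) with i ≟ j
  ... | yes _ = con c
  ... | no i≢j = var (punchOut i≢j)
  substTerm i c (con k) = con k
  substTerm i c (app f ts) = app f (substTerms i c ts)
  substTerms i c [] = []
  substTerms i c (t ∷ ts) = substTerm i c t ∷ substTerms i c ts

  substAt : ∀ {n} → Fin (suc n) → K → Formula τ K (suc n) → Formula τ K n
  substAt i c (rel R ts) = rel R (substTerms i c ts)
  substAt i c (t ≐ u) = substTerm i c t ≐ substTerm i c u
  substAt i c ⊥̇ = ⊥̇
  substAt i c (¬̇ φ) = ¬̇ substAt i c φ
  substAt i c (φ ∧̇ ψ) = substAt i c φ ∧̇ substAt i c ψ
  substAt i c (φ ∨̇ ψ) = substAt i c φ ∨̇ substAt i c ψ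
  substAt i c (φ ⇒̇ ψ) = substAt i c φ ⇒̇ substAt i c ψ
  substAt i c (∀̇ φ) = ∀̇ (substAt (suc i) c φ)
  substAt i c (∃̇ φ) = ∃̇ (substAt (suc i) c φ)

  -- φ(c, d̄) from φ(x, d̄): x is the unique free variable, d̄ are constants
  _[_] : Formula τ K 1 → K → Sentence τ K
  φ [ c ] = substAt zero c φ

Valuation : (τ : Vocabulary) → Set → Set
Valuation τ K = Sentence τ K → Maybe Bool

IsTrue : ∀ {τ K} → Valuation τ K → Sentence τ K → Set
IsTrue v s = v s ≡ just true

module _ {τ : Vocabulary} (E : ConstExpansion τ) where

  data IRule : Set where
    I-ω  : Formula τ (C E) 1 → IRule
    I-∀E : Formula τ (C E) 1 → C E → IRule
    I-∃I : Formula τ (C E) 1 → C E → IRule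
    I-∃E : Formula τ (C E) 1 → IRule

  premises : IRule → Sentence τ (C E) → Set
  premises (I-ω φ) s = Σ (Const τ) λ c → s ≡ φ [ embed E c ]
  premises (I-∀E φ c) s = s ≡ ∀̇ φ
  premises (I-∃I φ c) s = s ≡ φ [ c ]
  premises (I-∃E φ) s = s ≡ ∃̇ φ

  -- (possibly disjunctive) set of conclusions
  conclusions : IRule → Sentence τ (C E) → Set
  conclusions (I-ω φ) s = s ≡ ∀̇ φ
  conclusions (I-∀E φ c) s = s ≡ φ [ c ]
  conclusions (I-∃I φ c) s = s ≡ ∃̇ φ
  conclusions (I-∃E φ) s = Σ (C E) λ c → s ≡ φ [ c ]

  Admissible : Valuation τ (C E) → Set
  Admissible v = (r : IRule) →
    ((s : Sentence τ (C E)) → premises r s → IsTrue v s) →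
    Σ (Sentence τ (C E)) λ s → conclusions r s × IsTrue v s

{-# OPTIONS --safe #-}
module Submission where

open import Defs
open import Function.Base using (id)
open import Function.Bundles using (_⇔_; mk⇔)
open import Data.Product using (_,_)
open import Relation.Binary.PropositionalEquality using (_≡_; refl; subst)

module _ {τ : Vocabulary} {E : ConstExpansion τ} {v : Valuation τ (C E)}
         (adm : Admissible E v) where

  conclusion-true : (r : IRule E) {t : Sentence τ (C E)} →
    (∀ {s} → conclusions E r s → s ≡ t) →
    ((s : Sentence τ (C E)) → premises E r s → IsTrue v s) →
    IsTrue v t
  conclusion-true r only-t premises-true with adm r premises-true
  ... | s , s-concludes , s-true = subst (IsTrue v) (only-t s-concludes) s-true

  ∀E-preserves-truth : (φ : Formula τ (C E) 1) →
    IsTrue v (∀̇ φ) → (c : C E) → IsTrue v (φ [ c ])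
  ∀E-preserves-truth φ ∀φ-true c =
    conclusion-true (I-∀E φ c) id (λ { _ refl → ∀φ-true })

  ω-preserves-truth : (φ : Formula τ (C E) 1) →
    ((c : Const τ) → IsTrue v (φ [ embed E c ])) → IsTrue v (∀̇ φ)
  ω-preserves-truth φ instances-true =
    conclusion-true (I-ω φ) id (λ { _ (c , refl) → instances-true c })

proposition4p1p2 : (τ : Vocabulary) (E : ConstExpansion τ)
    (v : Valuation τ (C E)) → Admissible E v →
    (φ : Formula τ (C E) 1) →
    IsTrue v (∀̇ φ) ⇔ ((c : Const τ) → IsTrue v (φ [ embed E c ]))
proposition4p1p2 τ E v adm φ =
  mk⇔ (λ ∀φ-true c → ∀E-preserves-truth adm φ ∀φ-true (embed E c))
      (ω-preserves-truth adm φ)
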